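{- Let $p$ be a prime and $r\ge1$ an integer. Then $\frac{1}{r(p-1)}$ is exact in base $p^r$ if and only if $p=2$ and $r$ is a power of $2$.
   Context: A real number $q$ is called exact in base $b$ if it has a base-$b$ expansion whose digits are eventually all $0$ (equivalently, one whose digits are eventually all $b-1$); i.e. $qb^k\in\mathbb{Z}$ for some $k\ge0$. -}

module Defs where

open import Data.Nat using (ℕ; _^_)
open import Data.Integer using (ℤ)
open import Data.Rational using (ℚ; _*_; _/_)
open import Data.Product using (∃; ∃-syntax)
open import Relation.Binary.PropositionalEquality using (_≡_)

ℕ→ℚ : ℕ → ℚ
ℕ→ℚ n = (Data.Integer.+ n) / 1

ExactInBase : ℕ → ℚ → Set
ExactInBase b q = ∃[ k ] ∃[ z ] (q * ℕ→ℚ (b ^ k) ≡ z / 1)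

IsPowerOf2 : ℕ → Set
IsPowerOf2 n = ∃[ m ] (n ≡ 2 ^ m)

module Submission where

-- For d ≠ 0, the rational (1/d)·N is an integer exactly when d ∣ N,
-- so 1/d is exact in base b iff d divides some power b^k.  With d = r(p-1) and
-- b = p^r this says r(p-1) ∣ p^(rk) for some k.
--   (⇒) p-1 is coprime to p, and the only number coprime to p dividing a power
--       of p is 1; hence p = 2.  Then r divides a power of the prime 2, and every
--       divisor of a prime power is itself a power of that prime.
--   (⇐) If p = 2 and r = 2^m then r(p-1) = 2^m divides (2^r)^m = 2^(rm), since
--       m ≤ rm.

open import Defs
open import Data.Nat using (ℕ; _*_; _∸_; _^_; _≥_; NonZero)
open import Data.Nat.Primality using (Prime)
open import Data.Integer using (+_)
open import Data.Rational using (_/_)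
open import Data.Product using (_×_)
open import Function.Bundles using (_⇔_)
open import Relation.Binary.PropositionalEquality using (_≡_)

open import Data.Nat using (zero; suc; _≤_)
open import Data.Nat.Properties using (n<1+n; *-comm; ^-*-assoc; ^-distribˡ-+-*; m≤n*m; m^n≢0; m≤n⇒∃[o]m+o≡n)
  renaming (*-identityʳ to ℕ-*-identityʳ)
open import Data.Nat.Divisibility
open import Data.Nat.Coprimality using (Coprime; coprime-divisor; prime⇒coprime)
  renaming (sym to coprime-sym)
open import Data.Nat.Primality using (prime[2]; prime⇒irreducible; prime⇒nonZero)
open import Data.Integer as ℤ using (ℤ; ∣_∣)
open import Data.Integer.Properties using (abs-*; pos-*; *-identityˡ; *-identityʳ)
open import Data.Rational using (ℚ; toℚᵘ) renaming (_*_ to _*ℚ_)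
open import Data.Rational.Properties using (toℚᵘ-fromℚᵘ; toℚᵘ-cong; toℚᵘ-homo-*; toℚᵘ-injective)
open import Data.Rational.Unnormalised as ℚᵘ using (mkℚᵘ; *≡*; _≃_)
open import Data.Rational.Unnormalised.Properties using (*-cong; ≃-sym; module ≃-Reasoning)
open import Data.Product using (_,_; ∃-syntax)
open import Data.Sum using (inj₁; inj₂)
open import Function using (_∘_)
open import Function.Bundles using (mk⇔; Equivalence)
open import Relation.Nullary using (yes; no; ¬_; contradiction)
open import Relation.Binary.PropositionalEquality using (refl; sym; trans; cong; subst; subst₂)

open Equivalence using (to; from)

^-monoʳ-∣ : ∀ a {m n} → m ≤ n → a ^ m ∣ a ^ n
^-monoʳ-∣ a {m} m≤n with m≤n⇒∃[o]m+o≡n m≤n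
... | o , refl = divides (a ^ o) (trans (^-distribˡ-+-* a m o) (*-comm (a ^ m) (a ^ o)))

coprime∧∣^⇒≡1 : ∀ {a b} n → Coprime a b → a ∣ b ^ n → a ≡ 1
coprime∧∣^⇒≡1 zero    _     a∣1    = ∣1⇒≡1 a∣1
coprime∧∣^⇒≡1 (suc n) a⊥b a∣b^1+n = coprime∧∣^⇒≡1 n a⊥b (coprime-divisor a⊥b a∣b^1+n)

¬∣⇒coprime : ∀ {p d} → Prime p → ¬ (p ∣ d) → Coprime d p
¬∣⇒coprime pp p∤d (c∣d , c∣p) with prime⇒irreducible pp c∣p
... | inj₁ c≡1    = c≡1
... | inj₂ refl   = contradiction c∣d p∤d

-- Every divisor of a prime power p^n is a power of p: strip factors p from d
-- one at a time; once p ∤ d, d is coprime to p and divides p^n, so d = 1.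
∣prime^⇒prime^ : ∀ {p d} n → Prime p → d ∣ p ^ n → ∃[ m ] d ≡ p ^ m
∣prime^⇒prime^ zero _ d∣1 = 0 , ∣1⇒≡1 d∣1
∣prime^⇒prime^ {p} {d} (suc n) pp d∣p^1+n with p ∣? d
... | no  p∤d = 0 , coprime∧∣^⇒≡1 (suc n) (¬∣⇒coprime pp p∤d) d∣p^1+n
... | yes (divides q refl) with ∣prime^⇒prime^ n pp q∣p^n
  where
  instance
    p≢0 : NonZero p
    p≢0 = prime⇒nonZero pp
  q∣p^n : q ∣ p ^ n
  q∣p^n = *-cancelʳ-∣ p (subst (q * p ∣_) (*-comm p (p ^ n)) d∣p^1+n)
...   | m , refl = suc m , *-comm (p ^ m) p

-- If p is prime and p-1 divides a power of p, then p = 2: p-1 is coprime to p.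
pred∣prime^⇒≡2 : ∀ {p} n → Prime p → p ∸ 1 ∣ p ^ n → p ≡ 2
pred∣prime^⇒≡2 {suc (suc t)} n pp t+1∣p^n
  with coprime∧∣^⇒≡1 n (coprime-sym (prime⇒coprime pp (n<1+n (suc t)))) t+1∣p^n
... | refl = refl

scaledUnit≃⇔ : ∀ k N (z : ℤ) →
               mkℚᵘ (+ 1) k ℚᵘ.* mkℚᵘ (+ N) 0 ≃ mkℚᵘ z 0 ⇔ + N ≡ z ℤ.* + suc k
scaledUnit≃⇔ k N z = mk⇔ (λ { (*≡* e) → trans (sym lhs) (trans e rhs) })
                         (λ e → *≡* (trans lhs (trans e (sym rhs))))
  where
  lhs : (+ 1 ℤ.* + N) ℤ.* + 1 ≡ + N
  lhs = trans (*-identityʳ (+ 1 ℤ.* + N)) (*-identityˡ (+ N))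
  rhs : z ℤ.* (+ suc k ℤ.* + 1) ≡ z ℤ.* + suc k
  rhs = cong (z ℤ.*_) (*-identityʳ (+ suc k))

scaledUnit≡⇔≃ : ∀ k N (z : ℤ) →
                (+ 1 / suc k) *ℚ ℕ→ℚ N ≡ z / 1 ⇔
                mkℚᵘ (+ 1) k ℚᵘ.* mkℚᵘ (+ N) 0 ≃ mkℚᵘ z 0
scaledUnit≡⇔≃ k N z = mk⇔ forward (toℚᵘ-injective ∘ backward)
  where
  open ≃-Reasoning
  x y : ℚ
  x = + 1 / suc k
  y = ℕ→ℚ N
  embed : toℚᵘ (x *ℚ y) ≃ mkℚᵘ (+ 1) k ℚᵘ.* mkℚᵘ (+ N) 0
  embed = begin
    toℚᵘ (x *ℚ y)                  ≈⟨ toℚᵘ-homo-* x y ⟩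
    toℚᵘ x ℚᵘ.* toℚᵘ y             ≈⟨ *-cong (toℚᵘ-fromℚᵘ (mkℚᵘ (+ 1) k)) (toℚᵘ-fromℚᵘ (mkℚᵘ (+ N) 0)) ⟩
    mkℚᵘ (+ 1) k ℚᵘ.* mkℚᵘ (+ N) 0 ∎
  forward : x *ℚ y ≡ z / 1 → mkℚᵘ (+ 1) k ℚᵘ.* mkℚᵘ (+ N) 0 ≃ mkℚᵘ z 0
  forward e = begin
    mkℚᵘ (+ 1) k ℚᵘ.* mkℚᵘ (+ N) 0 ≈⟨ ≃-sym embed ⟩
    toℚᵘ (x *ℚ y)                  ≈⟨ toℚᵘ-cong e ⟩
    toℚᵘ (z / 1)                   ≈⟨ toℚᵘ-fromℚᵘ (mkℚᵘ z 0) ⟩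
    mkℚᵘ z 0 ∎
  backward : mkℚᵘ (+ 1) k ℚᵘ.* mkℚᵘ (+ N) 0 ≃ mkℚᵘ z 0 → toℚᵘ (x *ℚ y) ≃ toℚᵘ (z / 1)
  backward e = begin
    toℚᵘ (x *ℚ y)                  ≈⟨ embed ⟩
    mkℚᵘ (+ 1) k ℚᵘ.* mkℚᵘ (+ N) 0 ≈⟨ e ⟩
    mkℚᵘ z 0                       ≈⟨ ≃-sym (toℚᵘ-fromℚᵘ (mkℚᵘ z 0)) ⟩
    toℚᵘ (z / 1) ∎

integral⇔∣ : ∀ d .{{_ : NonZero d}} N → (∃[ z ] (+ 1 / d) *ℚ ℕ→ℚ N ≡ z / 1) ⇔ d ∣ N
integral⇔∣ (suc k) N = mk⇔ toDivides fromDivides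
  where
  equation : ∀ z → (+ 1 / suc k) *ℚ ℕ→ℚ N ≡ z / 1 ⇔ + N ≡ z ℤ.* + suc k
  equation z = mk⇔ (to (scaledUnit≃⇔ k N z) ∘ to (scaledUnit≡⇔≃ k N z))
                   (from (scaledUnit≡⇔≃ k N z) ∘ from (scaledUnit≃⇔ k N z))
  toDivides : (∃[ z ] (+ 1 / suc k) *ℚ ℕ→ℚ N ≡ z / 1) → suc k ∣ N
  toDivides (z , e) = divides ∣ z ∣ (trans (cong ∣_∣ (to (equation z) e)) (abs-* z (+ suc k)))
  fromDivides : suc k ∣ N → ∃[ z ] (+ 1 / suc k) *ℚ ℕ→ℚ N ≡ z / 1
  fromDivides (divides q e) = + q , from (equation (+ q)) (trans (cong +_ e) (pos-* q (suc k)))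

exactUnitFraction⇔ : ∀ b d .{{_ : NonZero d}} → ExactInBase b (+ 1 / d) ⇔ (∃[ k ] d ∣ b ^ k)
exactUnitFraction⇔ b d = mk⇔ (λ (k , integral) → k , to (integral⇔∣ d (b ^ k)) integral)
                             (λ (k , d∣b^k) → k , from (integral⇔∣ d (b ^ k)) d∣b^k)

lemma3 : (p r : ℕ) → Prime p → r ≥ 1 → .{{_ : NonZero (r * (p ∸ 1))}} →
         ExactInBase (p ^ r) ((+ 1) / (r * (p ∸ 1))) ⇔ (p ≡ 2 × IsPowerOf2 r)
lemma3 p r pp _ = mk⇔ (necessary ∘ to exact⇔) (from exact⇔ ∘ sufficient)
  where
  exact⇔ : ExactInBase (p ^ r) (+ 1 / (r * (p ∸ 1))) ⇔ (∃[ k ] r * (p ∸ 1) ∣ (p ^ r) ^ k)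
  exact⇔ = exactUnitFraction⇔ (p ^ r) (r * (p ∸ 1))
  necessary : (∃[ k ] r * (p ∸ 1) ∣ (p ^ r) ^ k) → p ≡ 2 × IsPowerOf2 r
  necessary (k , d∣p^rk) =
    p≡2 , ∣prime^⇒prime^ (r * k) prime[2] (subst (λ q → r ∣ q ^ (r * k)) p≡2 r∣p^n)
    where
    d∣p^n : r * (p ∸ 1) ∣ p ^ (r * k)
    d∣p^n = subst (r * (p ∸ 1) ∣_) (^-*-assoc p r k) d∣p^rk
    p≡2 : p ≡ 2
    p≡2 = pred∣prime^⇒≡2 (r * k) pp (∣-trans (n∣m*n r) d∣p^n)
    r∣p^n : r ∣ p ^ (r * k)
    r∣p^n = ∣-trans (m∣m*n (p ∸ 1)) d∣p^n
  -- With r = 2^m, take k = m: 2^m ∣ 2^(rm) because m ≤ rm.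
  sufficient : p ≡ 2 × IsPowerOf2 r → ∃[ k ] r * (p ∸ 1) ∣ (p ^ r) ^ k
  sufficient (refl , m , refl) = m , subst₂ _∣_ (sym (ℕ-*-identityʳ r)) (sym (^-*-assoc 2 r m)) 2^m∣2^rm
    where
    instance
      2^m≢0 : NonZero (2 ^ m)
      2^m≢0 = m^n≢0 2 m
    2^m∣2^rm : 2 ^ m ∣ 2 ^ (r * m)
    2^m∣2^rm = ^-monoʳ-∣ 2 (m≤n*m m r)
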